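{- Let $T$ be a tree. If $T$ is $(\iota,1)$-critical, then $T\in\mathcal{F}_\iota$.
   Context: For $D\subseteq V(T)$, $N[D]$ is $D$ with all neighbours; $D$ is isolating if $T-N[D]$ has no edges; $\iota(T)$ is the minimum size of an isolating set. $T_e$ is obtained by subdividing edge $e$ once. $T$ is $(\iota,1)$-critical if $\iota(T_e)>\iota(T)$ for every edge $e$ (and $T$ has an edge). The family $\mathcal{F}_\iota$ consists of trees $T$ for which there is a sequence $T_1,\dots,T_j$ ($j\ge1$) with $T_1=P_5$, $T_j=T$, each $T_{i+1}$ obtained from $T_i$ by one of the operations below, where each vertex carries a status $A$, $B$ or $C$ that, once assigned, never changes. In $T_1=P_5$ the middle vertex has status $A$, the two support vertices have status $B$, the two leaves have status $C$. Operation $\mathcal{O}_1$: add a new vertex $x$ and an edge $xy$ where $y$ has status $B$; the new vertex $x$ gets status $C$. Operation $\mathcal{O}_2$: add a path $u v$ and an edge $xu$ where $x$ has status $A$; $u$ gets status $B$ and $v$ gets status $C$. Operation $\mathcal{O}_3$: add a path $u v w z$ and an edge $xu$ where $x$ has status $C$; $u,v,w,z$ get statuses $B,A,B,C$ respectively. -}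

module Defs where

open import Data.Nat using (ℕ; zero; suc; _+_; _≤_; _<_)
open import Data.Fin using (Fin; zero; suc; _≟_)
import Data.Fin
import Data.Nat
open import Data.Fin.Subset using (Subset; _∈_; ∣_∣)
open import Data.Fin.Permutation using (Permutation′; _⟨$⟩ʳ_)
open import Data.Bool using (Bool; true; false; _∧_; _∨_; not; T)
open import Data.List using (List; []; _∷_; _++_; [_]; length)
open import Data.List.Relation.Unary.Unique.Propositional using (Unique)
open import Data.Product using (Σ; ∃; _×_; _,_)
open import Data.Sum using (_⊎_)
open import Data.Unit using (⊤)
open import Relation.Nullary using (¬_)
open import Relation.Nullary.Decidable using (⌊_⌋)
open import Relation.Binary.PropositionalEquality using (_≡_)

-- Finite simple graphs on vertex set Fin n, given by a Boolean adjacency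
-- function (required to be symmetric and irreflexive where relevant).

Adj : ℕ → Set
Adj n = Fin n → Fin n → Bool

E : ∀ {n} → Adj n → Fin n → Fin n → Set
E adj u v = T (adj u v)

Symmetric : ∀ {n} → Adj n → Set
Symmetric adj = ∀ u v → adj u v ≡ adj v u

Irreflexive : ∀ {n} → Adj n → Set
Irreflexive adj = ∀ u → adj u u ≡ false

data Walk {n} (adj : Adj n) : Fin n → Fin n → Set where
  here : ∀ {u} → Walk adj u u
  step : ∀ {u w v} → E adj u w → Walk adj w v → Walk adj u v

Connected : ∀ {n} → Adj n → Set
Connected adj = ∀ u v → Walk adj u v

Chain : ∀ {n} → Adj n → List (Fin n) → Set
Chain adj [] = ⊤
Chain adj (x ∷ []) = ⊤
Chain adj (x ∷ y ∷ r) = E adj x y × Chain adj (y ∷ r)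

Cycle : ∀ {n} → Adj n → Set
Cycle {n} adj = Σ (Fin n) λ x → Σ (List (Fin n)) λ vs →
  Unique (x ∷ vs) × (2 ≤ length vs) × Chain adj (x ∷ vs ++ [ x ])

Acyclic : ∀ {n} → Adj n → Set
Acyclic adj = ¬ Cycle adj

IsTree : ∀ {n} → Adj n → Set
IsTree {n} adj = (1 ≤ n) × Symmetric adj × Irreflexive adj × Connected adj × Acyclic adj

HasEdge : ∀ {n} → Adj n → Set
HasEdge {n} adj = Σ (Fin n) λ u → Σ (Fin n) λ v → E adj u v

InClosedNbhd : ∀ {n} → Adj n → Subset n → Fin n → Set
InClosedNbhd {n} adj D v = (v ∈ D) ⊎ (Σ (Fin n) λ d → (d ∈ D) × E adj d v)

Isolating : ∀ {n} → Adj n → Subset n → Set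
Isolating adj D = ∀ u v → E adj u v → InClosedNbhd adj D u ⊎ InClosedNbhd adj D v

IsIota : ∀ {n} → Adj n → ℕ → Set
IsIota {n} adj k =
  (Σ (Subset n) λ D → Isolating adj D × ∣ D ∣ ≡ k) ×
  (∀ (D : Subset n) → Isolating adj D → k ≤ ∣ D ∣)

-- Subdividing the edge ab once; the new vertex is `zero`, old vertex v is `suc v`.

subdivide : ∀ {n} → Adj n → Fin n → Fin n → Adj (suc n)
subdivide adj a b zero zero = false
subdivide adj a b zero (suc v) = ⌊ v ≟ a ⌋ ∨ ⌊ v ≟ b ⌋
subdivide adj a b (suc u) zero = ⌊ u ≟ a ⌋ ∨ ⌊ u ≟ b ⌋
subdivide adj a b (suc u) (suc v) =
  adj u v ∧ not ((⌊ u ≟ a ⌋ ∧ ⌊ v ≟ b ⌋) ∨ (⌊ u ≟ b ⌋ ∧ ⌊ v ≟ a ⌋))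

IotaCritical : ∀ {n} → Adj n → Set
IotaCritical {n} adj = HasEdge adj ×
  (∀ (a b : Fin n) → E adj a b → ∀ k k' →
     IsIota adj k → IsIota (subdivide adj a b) k' → k < k')

data Status : Set where
  A B C : Status

-- add a new vertex (`zero`) joined to y; old vertex v becomes `suc v`
addLeaf : ∀ {n} → Adj n → Fin n → Adj (suc n)
addLeaf adj y zero zero = false
addLeaf adj y zero (suc v) = ⌊ v ≟ y ⌋
addLeaf adj y (suc u) zero = ⌊ u ≟ y ⌋
addLeaf adj y (suc u) (suc v) = adj u v

extend : ∀ {n} → (Fin n → Status) → Status → (Fin (suc n) → Status)
extend st s zero = s
extend st s (suc i) = st i

adjP5 : Adj 5
adjP5 u v = ⌊ Data.Fin.toℕ u Data.Nat.≟ suc (Data.Fin.toℕ v) ⌋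
          ∨ ⌊ Data.Fin.toℕ v Data.Nat.≟ suc (Data.Fin.toℕ u) ⌋

statusP5 : Fin 5 → Status
statusP5 zero = C
statusP5 (suc zero) = B
statusP5 (suc (suc zero)) = A
statusP5 (suc (suc (suc zero))) = B
statusP5 (suc (suc (suc (suc zero)))) = C

data Build : (n : ℕ) → Adj n → (Fin n → Status) → Set where
  start : Build 5 adjP5 statusP5
  op1 : ∀ {n adj st} → Build n adj st → (y : Fin n) → st y ≡ B →
        Build (suc n) (addLeaf adj y) (extend st C)
  -- O₂: new path u v (statuses B, C) with u joined to x of status A
  op2 : ∀ {n adj st} → Build n adj st → (x : Fin n) → st x ≡ A →
        Build (suc (suc n)) (addLeaf (addLeaf adj x) zero)
              (extend (extend st B) C)
  -- O₃: new path u v w z (statuses B, A, B, C) with u joined to x of status C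
  op3 : ∀ {n adj st} → Build n adj st → (x : Fin n) → st x ≡ C →
        Build (suc (suc (suc (suc n))))
              (addLeaf (addLeaf (addLeaf (addLeaf adj x) zero) zero) zero)
              (extend (extend (extend (extend st B) A) B) C)

InFιota : ∀ {n} → Adj n → Set
InFιota {n} adj = Σ (Adj n) λ adj' → Σ (Fin n → Status) λ st →
  Build n adj' st × Σ (Permutation′ n) λ σ →
    ∀ u v → adj u v ≡ adj' (σ ⟨$⟩ʳ u) (σ ⟨$⟩ʳ v)

{-# OPTIONS --safe #-}
module Submission where

-- Fix a minimum isolating set D of the critical tree T and give a vertex status A if it lies in D,
-- B if it lies in N[D] - D, and C otherwise.  After subdividing an edge e, no set of size ι(T)
-- isolates T_e; applied to D itself (or to D with a leaf replaced by the subdivision vertex) this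
-- shows that every edge joins a B-vertex to an A- or C-vertex, that every B-vertex has exactly one
-- A-neighbour and some C-neighbour, and that no A-vertex is a leaf.  These are exactly the local
-- rules of O₁, O₂ and O₃: starting from a path C B A B C, any edge leaving the part of T built so
-- far can be followed by the leaf, the path B C or the path B A B C that the statuses dictate, and
-- acyclicity of T keeps the built part an induced subtree until it is all of T.

open import Defs
open import Data.Bool using (T; false)
import Data.Bool.Properties as Bool
open import Data.Empty using (⊥-elim)
open import Data.Fin using (Fin; zero; suc; _≟_)
open import Data.Fin.Permutation using (permutation)
open import Data.Fin.Properties using (any?; all?; ¬∀⟶∃¬; injective⇒≤; suc-injective)
open import Data.Fin.Subset using (Subset; _∈_; _∉_; ∣_∣; ⊤; inside; outside; _-_)
open import Data.Fin.Subset.Properties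
  using (_∈?_; anySubset?; ∈⊤; x∈p∧x≢y⇒x∈p-y; x∈p⇒∣p-x∣<∣p∣)
open import Data.List using (List; _∷_; _++_; [_]; length; map)
open import Data.List.Membership.Propositional using () renaming (_∈_ to _∈ₗ_; _∉_ to _∉ₗ_)
open import Data.List.Membership.Propositional.Properties using (∈-map⁻; ∈-++⁻)
open import Data.List.Properties using (length-map)
open import Data.List.Relation.Unary.All using ([])
open import Data.List.Relation.Unary.All.Properties using (¬Any⇒All¬)
open import Data.List.Relation.Unary.AllPairs using ([]; _∷_)
open import Data.List.Relation.Unary.Any using (here; there)
open import Data.List.Relation.Unary.Unique.Propositional using (Unique)
open import Data.Nat using (ℕ; zero; suc; _+_; _≤_; _<_; s≤s; z≤n; _<?_)
open import Data.Nat.Properties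
  using ( ≤-refl; ≤-reflexive; ≤-trans; ≤-antisym; <⇒≱; ≮⇒≥
        ; +-suc; +-identityʳ; +-monoˡ-≤; m≤n+m; n<1+n; n≤1+n)
open import Data.Product using (∃; ∃₂; _×_; _,_; proj₁; proj₂)
open import Data.Sum using (_⊎_; inj₁; inj₂)
import Data.Sum as Sum
open import Data.Unit using (tt)
open import Data.Vec using (_∷_; here; there)
open import Data.Vec.Functional using () renaming (_∷_ to _◂_)
open import Function using (_∘_; id)
open import Function.Definitions using (Injective)
open import Relation.Binary.PropositionalEquality
  using (_≡_; _≢_; refl; sym; trans; cong; cong₂; subst)
open import Relation.Nullary using (¬_; Dec; yes; no)
open import Relation.Nullary.Decidable
  using (⌊_⌋; isYes≗does; toWitness; fromWitness; decidable-stable; dec-true; dec-false)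
open import Relation.Nullary.Decidable.Core using (T?; ¬?; _×-dec_; _⊎-dec_; _→-dec_)
open import Relation.Unary using (Pred; Decidable)

E-sym : ∀ {n} {G : Adj n} → Symmetric G → ∀ {u v} → E G u v → E G v u
E-sym symmetric {u} {v} = subst T (symmetric u v)

E-irrefl : ∀ {n} {G : Adj n} → Irreflexive G → ∀ {u} → ¬ E G u u
E-irrefl irreflexive {u} = subst T (irreflexive u)

-- Minimum isolating sets and subdivisions

record MinimumIsolatingSet {n : ℕ} (G : Adj n) : Set where
  field
    D : Subset n
    isolating : Isolating G D
    minimum : ∀ D′ → Isolating G D′ → ∣ D ∣ ≤ ∣ D′ ∣

  iota : IsIota G ∣ D ∣
  iota = (D , isolating , refl) , minimum

module _ {n : ℕ} (G : Adj n) where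

  inClosedNbhd? : ∀ D v → Dec (InClosedNbhd G D v)
  inClosedNbhd? D v = (v ∈? D) ⊎-dec any? (λ d → (d ∈? D) ×-dec T? (G d v))

  isolating? : ∀ D → Dec (Isolating G D)
  isolating? D =
    all? λ u → all? λ v → T? (G u v) →-dec (inClosedNbhd? D u ⊎-dec inClosedNbhd? D v)

  private
    descend : ∀ fuel D → Isolating G D → ∣ D ∣ < fuel → MinimumIsolatingSet G
    descend (suc fuel) D isoD (s≤s ∣D∣≤fuel)
      with anySubset? (λ D′ → isolating? D′ ×-dec (∣ D′ ∣ <? ∣ D ∣))
    ... | yes (D′ , isoD′ , smaller) = descend fuel D′ isoD′ (≤-trans smaller ∣D∣≤fuel)
    ... | no none-smaller = record
      { D = D
      ; isolating = isoD
      ; minimum = λ D′ isoD′ → ≮⇒≥ λ smaller → none-smaller (D′ , isoD′ , smaller)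
      }

  minimumIsolatingSet : MinimumIsolatingSet G
  minimumIsolatingSet = descend (suc ∣ ⊤ {n} ∣) ⊤ (λ u _ _ → inj₁ (inj₁ ∈⊤)) ≤-refl

module Subdivision {n : ℕ} (G : Adj n) (a b : Fin n) where

  G′ : Adj (suc n)
  G′ = subdivide G a b

  IsEdgeAB : Fin n → Fin n → Set
  IsEdgeAB u v = (u ≡ a × v ≡ b) ⊎ (u ≡ b × v ≡ a)

  isEdgeAB? : ∀ u v → Dec (IsEdgeAB u v)
  isEdgeAB? u v = ((u ≟ a) ×-dec (v ≟ b)) ⊎-dec ((u ≟ b) ×-dec (v ≟ a))

  private
    old-edge? : ∀ u v → Dec (E G u v × ¬ IsEdgeAB u v)
    old-edge? u v = T? (G u v) ×-dec ¬? (isEdgeAB? u v)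

    new-edge? : ∀ v → Dec (v ≡ a ⊎ v ≡ b)
    new-edge? v = (v ≟ a) ⊎-dec (v ≟ b)

    -- ⌊_⌋ is stuck on open decisions, whereas `does` unfolds through _×-dec_, _⊎-dec_ and ¬?.
    subdivide-old : ∀ u v → G′ (suc u) (suc v) ≡ ⌊ old-edge? u v ⌋
    subdivide-old u v
      rewrite isYes≗does (old-edge? u v)
            | isYes≗does (u ≟ a) | isYes≗does (v ≟ b) | isYes≗does (u ≟ b) | isYes≗does (v ≟ a)
            = refl

    subdivide-new : ∀ v → G′ zero (suc v) ≡ ⌊ new-edge? v ⌋
    subdivide-new v
      rewrite isYes≗does (new-edge? v) | isYes≗does (v ≟ a) | isYes≗does (v ≟ b)
            = refl

  old-edge : ∀ {u v} → E G′ (suc u) (suc v) → E G u v × ¬ IsEdgeAB u v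
  old-edge {u} {v} e = toWitness (subst T (subdivide-old u v) e)

  kept-edge : ∀ {u v} → E G u v → ¬ IsEdgeAB u v → E G′ (suc u) (suc v)
  kept-edge {u} {v} e ¬ab = subst T (sym (subdivide-old u v)) (fromWitness (e , ¬ab))

  new-edge : ∀ {v} → E G′ zero (suc v) → v ≡ a ⊎ v ≡ b
  new-edge {v} e = toWitness (subst T (subdivide-new v) e)

  new-a : E G′ zero (suc a)
  new-a = subst T (sym (subdivide-new a)) (fromWitness (inj₁ refl))

  new-b : E G′ zero (suc b)
  new-b = subst T (sym (subdivide-new b)) (fromWitness (inj₂ refl))

  isolating-subdivide : ∀ D′ →
    (∀ u v → E G u v → ¬ IsEdgeAB u v →
       InClosedNbhd G′ D′ (suc u) ⊎ InClosedNbhd G′ D′ (suc v)) →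
    InClosedNbhd G′ D′ zero ⊎ (InClosedNbhd G′ D′ (suc a) × InClosedNbhd G′ D′ (suc b)) →
    Isolating G′ D′
  isolating-subdivide D′ old new zero zero ()
  isolating-subdivide D′ old (inj₁ N₀) zero (suc v) e = inj₁ N₀
  isolating-subdivide D′ old (inj₂ (Na , Nb)) zero (suc v) e with new-edge {v} e
  ... | inj₁ refl = inj₂ Na
  ... | inj₂ refl = inj₂ Nb
  isolating-subdivide D′ old (inj₁ N₀) (suc u) zero e = inj₂ N₀
  isolating-subdivide D′ old (inj₂ (Na , Nb)) (suc u) zero e with new-edge {u} e
  ... | inj₁ refl = inj₁ Na
  ... | inj₂ refl = inj₁ Nb
  isolating-subdivide D′ old new (suc u) (suc v) e =
    old u v (proj₁ (old-edge e)) (proj₂ (old-edge e))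

  module _ {D : Subset n} where

    lift-∈ : ∀ {w} → w ∈ D → InClosedNbhd G′ (outside ∷ D) (suc w)
    lift-∈ w∈D = inj₁ (there w∈D)

    lift-neighbour : ∀ {d w} → d ∈ D → E G d w → ¬ IsEdgeAB d w →
                     InClosedNbhd G′ (outside ∷ D) (suc w)
    lift-neighbour d∈D e ¬ab = inj₂ (suc _ , there d∈D , kept-edge e ¬ab)

    lift-new : a ∈ D → InClosedNbhd G′ (outside ∷ D) zero
    lift-new a∈D = inj₂ (suc a , there a∈D , new-a)

    lift-isolating : Isolating G D →
      (∀ {w} → InClosedNbhd G D w → InClosedNbhd G′ (outside ∷ D) (suc w)) →
      InClosedNbhd G′ (outside ∷ D) zero ⊎
        (InClosedNbhd G′ (outside ∷ D) (suc a) × InClosedNbhd G′ (outside ∷ D) (suc b)) →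
      Isolating G′ (outside ∷ D)
    lift-isolating isoD lift =
      isolating-subdivide (outside ∷ D) λ u v e _ → Sum.map lift lift (isoD u v e)

-- The statuses of a critical tree

data AllowedEdge : Status → Status → Set where
  A-B : AllowedEdge A B
  B-A : AllowedEdge B A
  B-C : AllowedEdge B C
  C-B : AllowedEdge C B

record StatusLabelling {n : ℕ} (G : Adj n) : Set where
  field
    status : Fin n → Status
    edge-kind : ∀ {u v} → E G u v → AllowedEdge (status u) (status v)
    B⇒A-neighbour : ∀ {b} → status b ≡ B → ∃ λ a → E G b a × status a ≡ A
    A-neighbour-unique : ∀ {b a a′} → status b ≡ B → E G b a → E G b a′ →
                         status a ≡ A → status a′ ≡ A → a ≡ a′
    B⇒C-neighbour : ∀ {b} → status b ≡ B → ∃ λ c → E G b c × status c ≡ C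
    A⇒other-neighbour : ∀ {a} → status a ≡ A → ∀ u → ∃ λ w → E G a w × w ≢ u
    some-A : ∃ λ a → status a ≡ A

  A-neighbour⇒B : ∀ {a b} → status a ≡ A → E G a b → status b ≡ B
  A-neighbour⇒B {a} {b} sa e = from-A (subst (λ s → AllowedEdge s (status b)) sa (edge-kind e))
    where
    from-A : ∀ {t} → AllowedEdge A t → t ≡ B
    from-A A-B = refl

  status-≢ : ∀ {u v s t} → status u ≡ s → status v ≡ t → s ≢ t → u ≢ v
  status-≢ su sv s≢t refl = s≢t (trans (sym su) sv)

module CriticalTree {n : ℕ} (G : Adj n) (symmetric : Symmetric G) (irreflexive : Irreflexive G)
                    (critical : IotaCritical G) (M : MinimumIsolatingSet G) where

  open MinimumIsolatingSet M renaming (isolating to isoD)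

  private
    flip-edge : ∀ {u v} → E G u v → E G v u
    flip-edge = E-sym symmetric

    no-loop : ∀ {u} → ¬ E G u u
    no-loop = E-irrefl {G = G} irreflexive

  N : Fin n → Set
  N = InClosedNbhd G D

  subdivision-needs-more : ∀ {a b} → E G a b →
                           ∀ D′ → Isolating (subdivide G a b) D′ → ¬ ∣ D′ ∣ ≤ ∣ D ∣
  subdivision-needs-more {a} {b} e D′ isoD′ small =
    <⇒≱ (proj₂ critical a b e _ _ iota (M′.iota)) (≤-trans (M′.minimum D′ isoD′) small)
    where module M′ = MinimumIsolatingSet (minimumIsolatingSet (subdivide G a b))

  lift-not-isolating : ∀ {a b} → E G a b → ¬ Isolating (subdivide G a b) (outside ∷ D)
  lift-not-isolating e iso = subdivision-needs-more e (outside ∷ D) iso ≤-refl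

  D-independent : ∀ {a b} → a ∈ D → b ∈ D → ¬ E G a b
  D-independent {a} {b} a∈D b∈D e =
    lift-not-isolating e (lift-isolating isoD lift (inj₁ (lift-new a∈D)))
    where
    open Subdivision G a b
    lift : ∀ {w} → N w → InClosedNbhd G′ (outside ∷ D) (suc w)
    lift (inj₁ w∈D) = lift-∈ w∈D
    lift {w} (inj₂ (d , d∈D , e′)) with w ∈? D
    ... | yes w∈D = lift-∈ w∈D
    ... | no w∉D =
      lift-neighbour d∈D e′ λ { (inj₁ (_ , refl)) → w∉D b∈D ; (inj₂ (_ , refl)) → w∉D a∈D }

  dominated-outside-D-nonadjacent : ∀ {a b} → a ∉ D → b ∉ D → N a → N b → ¬ E G a b
  dominated-outside-D-nonadjacent {a} {b} a∉D b∉D Na Nb e =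
    lift-not-isolating e (lift-isolating isoD lift (inj₂ (lift Na , lift Nb)))
    where
    open Subdivision G a b
    lift : ∀ {w} → N w → InClosedNbhd G′ (outside ∷ D) (suc w)
    lift (inj₁ w∈D) = lift-∈ w∈D
    lift (inj₂ (d , d∈D , e′)) =
      lift-neighbour d∈D e′ λ { (inj₁ (refl , _)) → a∉D d∈D ; (inj₂ (refl , _)) → b∉D d∈D }

  D-neighbour-unique : ∀ {a a′ b} → b ∉ D → a ∈ D → a′ ∈ D →
                       E G a b → E G a′ b → a ≡ a′
  D-neighbour-unique {a} {a′} {b} b∉D a∈D a′∈D e e′ with a ≟ a′
  ... | yes a≡a′ = a≡a′
  ... | no a≢a′ =
    ⊥-elim (lift-not-isolating e (lift-isolating isoD lift (inj₁ (lift-new a∈D))))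
    where
    open Subdivision G a b
    lift : ∀ {w} → N w → InClosedNbhd G′ (outside ∷ D) (suc w)
    lift (inj₁ w∈D) = lift-∈ w∈D
    lift {w} (inj₂ (d , d∈D , e″)) with isEdgeAB? d w
    ... | no ¬ab = lift-neighbour d∈D e″ ¬ab
    ... | yes (inj₁ (refl , refl)) =
      lift-neighbour a′∈D e′
        λ { (inj₁ (a′≡a , _)) → a≢a′ (sym a′≡a) ; (inj₂ (refl , _)) → b∉D a′∈D }
    ... | yes (inj₂ (refl , refl)) = ⊥-elim (b∉D d∈D)

  -- In T_ab only b can lose its domination; its edges then stay covered by their other ends.
  neighbours-not-all-dominated : ∀ {a b} → b ∉ D → a ∈ D → E G a b →
                                 ¬ (∀ {u} → E G b u → N u)
  neighbours-not-all-dominated {a} {b} b∉D a∈D e all-dominated =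
    lift-not-isolating e (isolating-subdivide (outside ∷ D) old (inj₁ (lift-new a∈D)))
    where
    open Subdivision G a b
    lift : ∀ {w} → w ≢ b → N w → InClosedNbhd G′ (outside ∷ D) (suc w)
    lift _ (inj₁ w∈D) = lift-∈ w∈D
    lift w≢b (inj₂ (d , d∈D , e′)) =
      lift-neighbour d∈D e′ λ { (inj₁ (_ , w≡b)) → w≢b w≡b ; (inj₂ (refl , _)) → b∉D d∈D }
    old : ∀ u v → E G u v → ¬ IsEdgeAB u v →
          InClosedNbhd G′ (outside ∷ D) (suc u) ⊎ InClosedNbhd G′ (outside ∷ D) (suc v)
    old u v e′ _ with u ≟ b | v ≟ b
    ... | yes refl | _ = inj₂ (lift (λ { refl → no-loop e′ }) (all-dominated e′))
    ... | no _ | yes refl = inj₁ (lift (λ { refl → no-loop e′ }) (all-dominated (flip-edge e′)))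
    ... | no u≢b | no v≢b = Sum.map (lift u≢b) (lift v≢b) (isoD u v e′)

  -- In T_ab the subdivision vertex can take the place of the leaf a in D.
  D-vertex-not-leaf : ∀ {a b} → a ∈ D → E G a b → ¬ (∀ {u} → E G a u → u ≡ b)
  D-vertex-not-leaf {a} {b} a∈D e only-b =
    subdivision-needs-more e D′ (isolating-subdivide D′ old (inj₁ (inj₁ here)))
      (x∈p⇒∣p-x∣<∣p∣ a∈D)
    where
    open Subdivision G a b
    D′ : Subset (suc n)
    D′ = inside ∷ (D - a)
    lift : ∀ {w} → w ≢ a → N w → InClosedNbhd G′ D′ (suc w)
    lift w≢a (inj₁ w∈D) = inj₁ (there (x∈p∧x≢y⇒x∈p-y w∈D w≢a))
    lift {w} w≢a (inj₂ (d , d∈D , e′)) with d ≟ a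
    ... | yes refl = inj₂ (zero , here , subst (E G′ zero ∘ suc) (sym (only-b e′)) new-b)
    ... | no d≢a = inj₂ (suc d , there (x∈p∧x≢y⇒x∈p-y d∈D d≢a) , kept-edge e′ not-ab)
      where
      not-ab : ¬ IsEdgeAB d w
      not-ab (inj₁ (d≡a , _)) = d≢a d≡a
      not-ab (inj₂ (_ , w≡a)) = w≢a w≡a
    old : ∀ u v → E G u v → ¬ IsEdgeAB u v →
          InClosedNbhd G′ D′ (suc u) ⊎ InClosedNbhd G′ D′ (suc v)
    old u v e′ ¬ab = Sum.map (lift λ { refl → ¬ab (inj₁ (refl , only-b e′)) })
                             (lift λ { refl → ¬ab (inj₂ (only-b (flip-edge e′) , refl)) })
                             (isoD u v e′)

  D-vertex-not-isolated : ∀ {a} → a ∈ D → ¬ (∀ {u} → ¬ E G a u)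
  D-vertex-not-isolated {a} a∈D isolated = <⇒≱ (x∈p⇒∣p-x∣<∣p∣ a∈D) (minimum (D - a) iso)
    where
    lift : ∀ {w} → w ≢ a → N w → InClosedNbhd G (D - a) w
    lift w≢a (inj₁ w∈D) = inj₁ (x∈p∧x≢y⇒x∈p-y w∈D w≢a)
    lift w≢a (inj₂ (d , d∈D , e)) =
      inj₂ (d , x∈p∧x≢y⇒x∈p-y d∈D (λ { refl → isolated e }) , e)
    iso : Isolating G (D - a)
    iso u v e = Sum.map (lift λ { refl → isolated e }) (lift λ { refl → isolated (flip-edge e) })
                        (isoD u v e)

  status : Fin n → Status
  status v with v ∈? D | inClosedNbhd? G D v
  ... | yes _ | _ = A
  ... | no _ | yes _ = B
  ... | no _ | no _ = C

  data StatusView (v : Fin n) : Status → Set where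
    in-D : v ∈ D → StatusView v A
    dominated : v ∉ D → N v → StatusView v B
    undominated : ¬ N v → StatusView v C

  status-view : ∀ v → StatusView v (status v)
  status-view v with v ∈? D | inClosedNbhd? G D v
  ... | yes v∈D | _ = in-D v∈D
  ... | no v∉D | yes Nv = dominated v∉D Nv
  ... | no _ | no ¬Nv = undominated ¬Nv

  view : ∀ {v s} → status v ≡ s → StatusView v s
  view {v} refl = status-view v

  status-∈ : ∀ {v} → v ∈ D → status v ≡ A
  status-∈ {v} v∈D with status v | status-view v
  ... | A | _ = refl
  ... | B | dominated v∉D _ = ⊥-elim (v∉D v∈D)
  ... | C | undominated ¬Nv = ⊥-elim (¬Nv (inj₁ v∈D))

  status-undominated : ∀ {v} → ¬ N v → status v ≡ C
  status-undominated {v} ¬Nv with status v | status-view v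
  ... | A | in-D v∈D = ⊥-elim (¬Nv (inj₁ v∈D))
  ... | B | dominated _ Nv = ⊥-elim (¬Nv Nv)
  ... | C | _ = refl

  edge-kind : ∀ {u v} → E G u v → AllowedEdge (status u) (status v)
  edge-kind {u} {v} e with status u | status-view u | status v | status-view v
  ... | A | in-D u∈D | A | in-D v∈D = ⊥-elim (D-independent u∈D v∈D e)
  ... | A | _ | B | _ = A-B
  ... | A | in-D u∈D | C | undominated ¬Nv = ⊥-elim (¬Nv (inj₂ (u , u∈D , e)))
  ... | B | _ | A | _ = B-A
  ... | B | dominated u∉D Nu | B | dominated v∉D Nv =
    ⊥-elim (dominated-outside-D-nonadjacent u∉D v∉D Nu Nv e)
  ... | B | _ | C | _ = B-C
  ... | C | undominated ¬Nu | A | in-D v∈D = ⊥-elim (¬Nu (inj₂ (v , v∈D , flip-edge e)))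
  ... | C | _ | B | _ = C-B
  ... | C | undominated ¬Nu | C | undominated ¬Nv = ⊥-elim (Sum.[ ¬Nu , ¬Nv ] (isoD u v e))

  B⇒A-neighbour : ∀ {b} → status b ≡ B → ∃ λ a → E G b a × status a ≡ A
  B⇒A-neighbour sb with view sb
  ... | dominated b∉D (inj₁ b∈D) = ⊥-elim (b∉D b∈D)
  ... | dominated _ (inj₂ (d , d∈D , e)) = d , flip-edge e , status-∈ d∈D

  A-neighbour-unique : ∀ {b a a′} → status b ≡ B → E G b a → E G b a′ →
                       status a ≡ A → status a′ ≡ A → a ≡ a′
  A-neighbour-unique sb e e′ sa sa′ with view sb | view sa | view sa′
  ... | dominated b∉D _ | in-D a∈D | in-D a′∈D =
    D-neighbour-unique b∉D a∈D a′∈D (flip-edge e) (flip-edge e′)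

  B⇒C-neighbour : ∀ {b} → status b ≡ B → ∃ λ c → E G b c × status c ≡ C
  B⇒C-neighbour {b} sb with any? (λ c → T? (G b c) ×-dec ¬? (inClosedNbhd? G D c)) | view sb
  ... | yes (c , e , ¬Nc) | _ = c , e , status-undominated ¬Nc
  ... | no _ | dominated b∉D (inj₁ b∈D) = ⊥-elim (b∉D b∈D)
  ... | no none | dominated b∉D (inj₂ (d , d∈D , e)) =
    ⊥-elim (neighbours-not-all-dominated b∉D d∈D e all-dominated)
    where
    all-dominated : ∀ {u} → E G b u → N u
    all-dominated {u} e′ = decidable-stable (inClosedNbhd? G D u) λ ¬Nu → none (u , e′ , ¬Nu)

  A⇒other-neighbour : ∀ {a} → status a ≡ A → ∀ u → ∃ λ w → E G a w × w ≢ u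
  A⇒other-neighbour {a} sa u with any? (λ w → T? (G a w) ×-dec ¬? (w ≟ u)) | view sa
  ... | yes found | _ = found
  ... | no none | in-D a∈D =
    ⊥-elim (D-vertex-not-isolated a∈D λ e →
              D-vertex-not-leaf a∈D e λ e′ → trans (only-u e′) (sym (only-u e)))
    where
    only-u : ∀ {w} → E G a w → w ≡ u
    only-u {w} e = decidable-stable (w ≟ u) λ w≢u → none (w , e , w≢u)

  dominator : ∀ {w} → N w → ∃ (_∈ D)
  dominator (inj₁ w∈D) = _ , w∈D
  dominator (inj₂ (d , d∈D , _)) = d , d∈D

  some-A : HasEdge G → ∃ λ a → status a ≡ A
  some-A (u , v , e) with Sum.[ dominator , dominator ]′ (isoD u v e)
  ... | d , d∈D = d , status-∈ d∈D

  labelling : HasEdge G → StatusLabelling G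
  labelling has-edge = record
    { status = status
    ; edge-kind = edge-kind
    ; B⇒A-neighbour = B⇒A-neighbour
    ; A-neighbour-unique = A-neighbour-unique
    ; B⇒C-neighbour = B⇒C-neighbour
    ; A⇒other-neighbour = A⇒other-neighbour
    ; some-A = some-A has-edge
    }

-- Simple paths and connected induced subgraphs

walk-crosses : ∀ {n} {G : Adj n} {p} {P : Pred (Fin n) p} → Decidable P →
               ∀ {u v} → Walk G u v → P u → ¬ P v → ∃₂ λ x y → P x × ¬ P y × E G x y
walk-crosses P? here Pu ¬Pv = ⊥-elim (¬Pv Pu)
walk-crosses P? (step {w = w} e walk) Pu ¬Pv with P? w
... | yes Pw = walk-crosses P? walk Pw ¬Pv
... | no ¬Pw = _ , w , Pu , ¬Pw , e

data SimplePath {m : ℕ} (H : Adj m) : Fin m → Fin m → List (Fin m) → Set where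
  trivial : ∀ {u} → SimplePath H u u [ u ]
  cons : ∀ {u w v l} → E H u w → u ∉ₗ l → SimplePath H w v l → SimplePath H u v (u ∷ l)

module _ {m : ℕ} {H : Adj m} where

  SimplePath⇒Unique : ∀ {u v l} → SimplePath H u v l → Unique l
  SimplePath⇒Unique trivial = [] ∷ []
  SimplePath⇒Unique (cons {l = l} _ u∉l p) = ¬Any⇒All¬ l u∉l ∷ SimplePath⇒Unique p

  SimplePath⇒Chain-∷ʳ : ∀ {u v l x} → SimplePath H u v l → E H v x → Chain H (l ++ [ x ])
  SimplePath⇒Chain-∷ʳ trivial e = e , tt
  SimplePath⇒Chain-∷ʳ (cons e′ _ trivial) e = e′ , e , tt
  SimplePath⇒Chain-∷ʳ (cons e′ _ p@(cons _ _ _)) e = e′ , SimplePath⇒Chain-∷ʳ p e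

  SimplePath-∷ʳ : ∀ {u v l x} → SimplePath H u v l → E H v x → x ∉ₗ l →
                  SimplePath H u x (l ++ [ x ])
  SimplePath-∷ʳ trivial e x∉ = cons e (λ { (here refl) → x∉ (here refl) }) trivial
  SimplePath-∷ʳ {x = x} (cons {l = l} e u∉l p) e′ x∉ =
    cons e u∉ (SimplePath-∷ʳ p e′ (x∉ ∘ there))
    where
    u∉ : _ ∉ₗ l ++ [ x ]
    u∉ u∈ with ∈-++⁻ l u∈
    ... | inj₁ u∈l = u∉l u∈l
    ... | inj₂ (here refl) = x∉ (here refl)

  SimplePath-length : ∀ {u v l} → SimplePath H u v l → u ≢ v → 2 ≤ length l
  SimplePath-length trivial u≢u = ⊥-elim (u≢u refl)
  SimplePath-length (cons _ _ trivial) _ = s≤s (s≤s z≤n)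
  SimplePath-length (cons _ _ (cons _ _ _)) _ = s≤s (s≤s z≤n)

SimplePath-map : ∀ {m m′} {H : Adj m} {H′ : Adj m′} (f : Fin m → Fin m′) →
                 Injective _≡_ _≡_ f → (∀ i j → H i j ≡ H′ (f i) (f j)) →
                 ∀ {u v l} → SimplePath H u v l → SimplePath H′ (f u) (f v) (map f l)
SimplePath-map f f-injective preserves trivial = trivial
SimplePath-map f f-injective preserves (cons {u = u} {w} e u∉l p) =
  cons (subst T (preserves u w) e) fu∉ (SimplePath-map f f-injective preserves p)
  where
  fu∉ : f u ∉ₗ map f _
  fu∉ fu∈ with ∈-map⁻ f fu∈
  ... | _ , x∈l , fu≡fx = u∉l (subst (_∈ₗ _) (sym (f-injective fu≡fx)) x∈l)

SimplyConnected : ∀ {m} → Adj m → Set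
SimplyConnected {m} H = ∀ u v → ∃ (SimplePath H u v)

point : Adj 1
point _ _ = false

point-simplyConnected : SimplyConnected point
point-simplyConnected zero zero = _ , trivial

leaf-edge : ∀ {m} {H : Adj m} {y} → E (addLeaf H y) zero (suc y)
leaf-edge {y = y} = fromWitness {a? = y ≟ y} refl

zero∉map-suc : ∀ {k} (l : List (Fin k)) → zero ∉ₗ map suc l
zero∉map-suc {k} l z∈ with ∈-map⁻ {A = Fin k} {B = Fin (suc k)} suc z∈
... | _ , _ , ()

addLeaf-simplyConnected : ∀ {m} {H : Adj m} → SimplyConnected H →
                          ∀ y → SimplyConnected (addLeaf H y)
addLeaf-simplyConnected {H = H} paths y = connect
  where
  shift : ∀ {u v l} → SimplePath H u v l → SimplePath (addLeaf H y) (suc u) (suc v) (map suc l)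
  shift = SimplePath-map suc suc-injective (λ _ _ → refl)
  connect : SimplyConnected (addLeaf H y)
  connect zero zero = _ , trivial
  connect (suc u) (suc v) with paths u v
  ... | l , p = map suc l , shift p
  connect zero (suc v) with paths y v
  ... | l , p = zero ∷ map suc l , cons (leaf-edge {H = H}) (zero∉map-suc l) (shift p)
  connect (suc u) zero with paths u y
  ... | l , p = map suc l ++ [ zero ] , SimplePath-∷ʳ (shift p) (leaf-edge {H = H}) (zero∉map-suc l)

record ConnectedInducedEmbedding {n m : ℕ} (G : Adj n) (H : Adj m) (f : Fin m → Fin n) : Set where
  field
    injective : Injective _≡_ _≡_ f
    induced : ∀ i j → H i j ≡ G (f i) (f j)
    simply-connected : SimplyConnected H

resp-≗ : ∀ {n m} {G : Adj n} {H H′ : Adj m} {f : Fin m → Fin n} →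
          (∀ i j → H i j ≡ H′ i j) →
          ConnectedInducedEmbedding G H f → ConnectedInducedEmbedding G H′ f
resp-≗ H≗H′ emb = record
  { injective = injective
  ; induced = λ i j → trans (sym (H≗H′ i j)) (induced i j)
  ; simply-connected = λ u v →
      let l , p = simply-connected u v in map id l , SimplePath-map id id H≗H′ p
  }
  where open ConnectedInducedEmbedding emb

module Embedding {n : ℕ} {G : Adj n}
                 (symmetric : Symmetric G) (irreflexive : Irreflexive G) (acyclic : Acyclic G) where

  private
    flip-edge : ∀ {u v} → E G u v → E G v u
    flip-edge = E-sym symmetric

  point-embedding : ∀ c → ConnectedInducedEmbedding G point (λ _ → c)
  point-embedding c = record
    { injective = λ { {zero} {zero} _ → refl }
    ; induced = λ { zero zero → sym (irreflexive c) }
    ; simply-connected = point-simplyConnected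
    }

  module _ {m : ℕ} {H : Adj m} {f : Fin m → Fin n} (emb : ConnectedInducedEmbedding G H f) where
    open ConnectedInducedEmbedding emb

    -- Two neighbours of t in the image, joined by a path inside the image, close a cycle through t.
    image-neighbour-unique : ∀ {t} → (∀ i → f i ≢ t) →
                             ∀ {i j} → E G t (f i) → E G t (f j) → i ≡ j
    image-neighbour-unique {t} out {i} {j} e e′ with i ≟ j | simply-connected i j
    ... | yes i≡j | _ = i≡j
    ... | no i≢j | _ , trivial = ⊥-elim (i≢j refl)
    ... | no i≢j | .(i ∷ l) , p@(cons {l = l} _ _ _) =
      ⊥-elim (acyclic (t , map f (i ∷ l) , unique , long , e ,
                       SimplePath⇒Chain-∷ʳ p′ (flip-edge e′)))
      where
      p′ = SimplePath-map f injective induced p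
      unique : Unique (t ∷ map f (i ∷ l))
      unique = ¬Any⇒All¬ _ (λ t∈ → let x , _ , t≡fx = ∈-map⁻ f t∈ in out x (sym t≡fx))
             ∷ SimplePath⇒Unique p′
      long : 2 ≤ length (map f (i ∷ l))
      long = subst (2 ≤_) (sym (length-map f (i ∷ l))) (SimplePath-length p i≢j)

    attach : ∀ x {y} → (∀ i → f i ≢ y) → E G (f x) y →
             ConnectedInducedEmbedding G (addLeaf H x) (y ◂ f)
    attach x {y} out e = record
      { injective = injective′
      ; induced = induced′
      ; simply-connected = addLeaf-simplyConnected simply-connected x
      }
      where
      injective′ : Injective _≡_ _≡_ (y ◂ f)
      injective′ {zero} {zero} _ = refl
      injective′ {zero} {suc j} y≡fj = ⊥-elim (out j (sym y≡fj))
      injective′ {suc i} {zero} fi≡y = ⊥-elim (out i fi≡y)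
      injective′ {suc i} {suc j} fi≡fj = cong suc (injective fi≡fj)
      leaf : ∀ v → ⌊ v ≟ x ⌋ ≡ G y (f v)
      leaf v with v ≟ x
      ... | yes refl = sym (dec-true (T? _) (flip-edge e))
      ... | no v≢x =
        sym (dec-false (T? _) λ e′ → v≢x (image-neighbour-unique out e′ (flip-edge e)))
      induced′ : ∀ i j → addLeaf H x i j ≡ G ((y ◂ f) i) ((y ◂ f) j)
      induced′ zero zero = sym (irreflexive y)
      induced′ zero (suc v) = leaf v
      induced′ (suc u) zero = trans (leaf u) (symmetric y (f u))
      induced′ (suc u) (suc v) = induced u v

    attach-outside : ∀ x {y z} → (∀ i → f i ≢ y) → E G (f x) y → E G y z → z ≢ f x →
                     ∀ i → (y ◂ f) i ≢ z
    attach-outside x out e e′ z≢fx zero refl = E-irrefl {G = G} irreflexive e′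
    attach-outside x out e e′ z≢fx (suc i) refl =
      z≢fx (cong f (image-neighbour-unique out e′ (flip-edge e)))

-- Growing the tree from P₅

HasANeighbour : ∀ {m} → Adj m → (Fin m → Status) → Fin m → Set
HasANeighbour H st i = ∃ λ j → E H i j × st j ≡ A

lift-A-neighbour : ∀ {m} {H : Adj m} {st y s i} →
                   HasANeighbour H st i → HasANeighbour (addLeaf H y) (extend st s) (suc i)
lift-A-neighbour (j , e , sA) = suc j , e , sA

built-B-has-A-neighbour : ∀ {m H st} → Build m H st → ∀ i → st i ≡ B → HasANeighbour H st i
built-B-has-A-neighbour start zero ()
built-B-has-A-neighbour start (suc zero) _ = suc (suc zero) , tt , refl
built-B-has-A-neighbour start (suc (suc zero)) ()
built-B-has-A-neighbour start (suc (suc (suc zero))) _ = suc (suc zero) , tt , refl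
built-B-has-A-neighbour start (suc (suc (suc (suc zero)))) ()
built-B-has-A-neighbour (op1 built y _) zero ()
built-B-has-A-neighbour (op1 built y _) (suc i) sB =
  lift-A-neighbour (built-B-has-A-neighbour built i sB)
built-B-has-A-neighbour (op2 built x _) zero ()
built-B-has-A-neighbour (op2 {adj = H} built x sA) (suc zero) _ = suc (suc x) , leaf-edge {H = H} , sA
built-B-has-A-neighbour (op2 built x _) (suc (suc i)) sB =
  lift-A-neighbour (lift-A-neighbour (built-B-has-A-neighbour built i sB))
built-B-has-A-neighbour (op3 built x _) zero ()
built-B-has-A-neighbour (op3 built x _) (suc zero) _ = suc (suc zero) , tt , refl
built-B-has-A-neighbour (op3 built x _) (suc (suc zero)) ()
built-B-has-A-neighbour (op3 built x _) (suc (suc (suc zero))) _ = suc (suc zero) , tt , refl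
built-B-has-A-neighbour (op3 built x _) (suc (suc (suc (suc i)))) sB =
  lift-A-neighbour (lift-A-neighbour (lift-A-neighbour (lift-A-neighbour
    (built-B-has-A-neighbour built i sB))))

built-vertex : ∀ {m H st} → Build m H st → Fin m
built-vertex start = zero
built-vertex (op1 _ _ _) = zero
built-vertex (op2 _ _ _) = zero
built-vertex (op3 _ _ _) = zero

path₅ : Adj 5
path₅ = addLeaf (addLeaf (addLeaf (addLeaf point zero) zero) zero) zero

path₅≗adjP5 : ∀ i j → path₅ i j ≡ adjP5 i j
path₅≗adjP5 = toWitness {a? = all? λ i → all? λ j → path₅ i j Bool.≟ adjP5 i j} tt

module Growing {n : ℕ} {G : Adj n} (symmetric : Symmetric G) (irreflexive : Irreflexive G)
               (connected : Connected G) (acyclic : Acyclic G) (L : StatusLabelling G) where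

  open StatusLabelling L
  open Embedding symmetric irreflexive acyclic

  private
    flip-edge : ∀ {u v} → E G u v → E G v u
    flip-edge = E-sym symmetric

  record Stage (m : ℕ) : Set where
    field
      H : Adj m
      st : Fin m → Status
      built : Build m H st
      f : Fin m → Fin n
      embedding : ConnectedInducedEmbedding G H f
      agrees : ∀ i → status (f i) ≡ st i

  agrees-◂ : ∀ {m} {f : Fin m → Fin n} {st y s} →
             (∀ i → status (f i) ≡ st i) → status y ≡ s →
             ∀ i → status ((y ◂ f) i) ≡ extend st s i
  agrees-◂ agrees sy zero = sy
  agrees-◂ agrees sy (suc i) = agrees i

  initial : Stage 5
  initial with some-A
  ... | a , sa with A⇒other-neighbour sa a
  ... | b₁ , e₁ , _ with A⇒other-neighbour sa b₁
  ... | b₂ , e₂ , b₂≢b₁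
    with B⇒C-neighbour (A-neighbour⇒B sa e₁) | B⇒C-neighbour (A-neighbour⇒B sa e₂)
  ... | c₁ , d₁ , sc₁ | c₂ , d₂ , sc₂ = record
    { H = adjP5
    ; st = statusP5
    ; built = start
    ; f = c₂ ◂ b₂ ◂ a ◂ b₁ ◂ (λ _ → c₁)
    ; embedding = resp-≗ path₅≗adjP5 emb₄
    ; agrees = λ { zero → sc₂ ; (suc zero) → sb₂ ; (suc (suc zero)) → sa
                 ; (suc (suc (suc zero))) → sb₁ ; (suc (suc (suc (suc zero)))) → sc₁ }
    }
    where
    sb₁ = A-neighbour⇒B sa e₁
    sb₂ = A-neighbour⇒B sa e₂
    emb₀ = point-embedding c₁
    out₀ : ∀ i → c₁ ≢ b₁
    out₀ _ = status-≢ sc₁ sb₁ λ ()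
    emb₁ = attach emb₀ zero out₀ (flip-edge d₁)
    out₁ = attach-outside emb₀ zero out₀ (flip-edge d₁) (flip-edge e₁) (status-≢ sa sc₁ λ ())
    emb₂ = attach emb₁ zero out₁ (flip-edge e₁)
    out₂ = attach-outside emb₁ zero out₁ (flip-edge e₁) e₂ b₂≢b₁
    emb₃ = attach emb₂ zero out₂ e₂
    out₃ = attach-outside emb₂ zero out₂ e₂ d₂ (status-≢ sc₂ sa λ ())
    emb₄ = attach emb₃ zero out₃ d₂

  Grows : ℕ → Set
  Grows m = ∃ λ m′ → Stage m′ × m < m′

  module _ {m : ℕ} (s : Stage m) where
    open Stage s

    InStage : Fin n → Set
    InStage w = ∃ λ i → f i ≡ w

    inStage? : Decidable InStage
    inStage? w = any? λ i → f i ≟ w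

    module _ {i y} (out : ∀ j → f j ≢ y) (e : E G (f i) y) where

      attach-C-to-B : status (f i) ≡ B → status y ≡ C → Grows m
      attach-C-to-B sB sC = suc m , stage , n<1+n m
        where
        stage : Stage (suc m)
        stage = record
          { built = op1 built i (trans (sym (agrees i)) sB)
          ; embedding = attach embedding i out e
          ; agrees = agrees-◂ agrees sC
          }

      attach-BC-to-A : status (f i) ≡ A → status y ≡ B → Grows m
      attach-BC-to-A sA sB with B⇒C-neighbour sB
      ... | z , d , sC = suc (suc m) , stage , s≤s (n≤1+n m)
        where
        out₁ = attach-outside embedding i out e d (status-≢ sC sA λ ())
        stage : Stage (suc (suc m))
        stage = record
          { built = op2 built i (trans (sym (agrees i)) sA)
          ; embedding = attach (attach embedding i out e) zero out₁ d
          ; agrees = agrees-◂ (agrees-◂ agrees sB) sC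
          }

      attach-BABC-to-C : status (f i) ≡ C → status y ≡ B → Grows m
      attach-BABC-to-C sC sB with B⇒A-neighbour sB
      ... | v , e₁ , sv with A⇒other-neighbour sv y
      ... | w , e₂ , w≢y with B⇒C-neighbour (A-neighbour⇒B sv e₂)
      ... | z , e₃ , sz = 4 + m , stage , s≤s (m≤n+m m 3)
        where
        sw = A-neighbour⇒B sv e₂
        emb₁ = attach embedding i out e
        out₁ = attach-outside embedding i out e e₁ (status-≢ sv sC λ ())
        emb₂ = attach emb₁ zero out₁ e₁
        out₂ = attach-outside emb₁ zero out₁ e₁ e₂ w≢y
        emb₃ = attach emb₂ zero out₂ e₂
        out₃ = attach-outside emb₂ zero out₂ e₂ e₃ (status-≢ sz sv λ ())
        stage : Stage (4 + m)
        stage = record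
          { built = op3 built i (trans (sym (agrees i)) sC)
          ; embedding = attach emb₃ zero out₃ e₃
          ; agrees = agrees-◂ (agrees-◂ (agrees-◂ (agrees-◂ agrees sB) sv) sw) sz
          }

      -- The A-neighbour of a B-vertex of the stage is in the stage and is unique.
      no-A-outside-B : status (f i) ≡ B → ¬ status y ≡ A
      no-A-outside-B sB sA with built-B-has-A-neighbour built i (trans (sym (agrees i)) sB)
      ... | j , eH , stA =
        out j (A-neighbour-unique sB (subst T (induced i j) eH) e (trans (agrees j) stA) sA)
        where open ConnectedInducedEmbedding embedding

      grow-across : Grows m
      grow-across = by-kind (edge-kind e) refl refl
        where
        by-kind : ∀ {s t} → AllowedEdge s t → status (f i) ≡ s → status y ≡ t → Grows m
        by-kind A-B = attach-BC-to-A
        by-kind B-A sB sA = ⊥-elim (no-A-outside-B sB sA)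
        by-kind B-C = attach-C-to-B
        by-kind C-B = attach-BABC-to-C

    grow-towards : ∀ {y} → ¬ InStage y → Grows m
    grow-towards {y} y∉
      with walk-crosses inStage? (connected (f (built-vertex built)) y) (_ , refl) y∉
    ... | _ , y′ , (i , refl) , y′∉ , e = grow-across (λ j fj≡y′ → y′∉ (j , fj≡y′)) e

  stage⇒InFι : ∀ {m} (s : Stage m) (g : Fin n → Fin m) →
               (∀ y → Stage.f s (g y) ≡ y) → m ≡ n → InFιota G
  stage⇒InFι s g fg refl =
    H , st , built , permutation g f (λ i → injective (fg (f i))) fg ,
    λ u v → sym (trans (induced (g u) (g v)) (cong₂ G (fg u) (fg v)))
    where
    open Stage s
    open ConnectedInducedEmbedding embedding

  covering-stage⇒InFι : ∀ {m} (s : Stage m) → (∀ y → InStage s y) → InFιota G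
  covering-stage⇒InFι s onto =
    stage⇒InFι s g fg (≤-antisym (injective⇒≤ injective) (injective⇒≤ g-injective))
    where
    open Stage s
    open ConnectedInducedEmbedding embedding
    g = proj₁ ∘ onto
    fg = proj₂ ∘ onto
    g-injective : Injective _≡_ _≡_ g
    g-injective {x} {y} gx≡gy = trans (sym (fg x)) (trans (cong f gx≡gy) (fg y))

  -- Each step adds a vertex of G, so n < m + fuel leaves enough fuel to cover G.
  grow : ∀ fuel {m} → Stage m → n < m + fuel → InFιota G
  grow fuel {m} s n<m+fuel with all? (inStage? s)
  ... | yes onto = covering-stage⇒InFι s onto
  ... | no ¬onto with ¬∀⟶∃¬ n (InStage s) (inStage? s) ¬onto | fuel
  ...   | y , y∉ | zero =
    ⊥-elim (<⇒≱ (subst (n <_) (+-identityʳ m) n<m+fuel) (injective⇒≤ injective))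
    where open ConnectedInducedEmbedding (Stage.embedding s)
  ...   | y , y∉ | suc fuel′ with grow-towards s y∉
  ...     | m′ , s′ , m<m′ =
    grow fuel′ s′ (≤-trans n<m+fuel (≤-trans (≤-reflexive (+-suc m fuel′)) (+-monoˡ-≤ fuel′ m<m′)))

  labelled-tree∈Fι : InFιota G
  labelled-tree∈Fι = grow n initial (s≤s (m≤n+m n 4))

theorem4p9 : ∀ (n : ℕ) (T : Adj n) → IsTree T → IotaCritical T → InFιota T
theorem4p9 n T (_ , symmetric , irreflexive , connected , acyclic) critical =
  Growing.labelled-tree∈Fι symmetric irreflexive connected acyclic (labelling (proj₁ critical))
  where open CriticalTree T symmetric irreflexive critical (minimumIsolatingSet T)
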